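{- Let $M\mapsto M^*$ be the translation from the untyped monadic reflection calculus to the untyped effect handler calculus that is homomorphic on all core constructs and satisfies $(\mathtt{reflect}\,N)^*=\mathit{reflect}\,\{N^*\}$ and $(\mathtt{reify}_T\,M)^*=\mathtt{handle}\,M^*\,\mathtt{with}\,\{\mathtt{return}\,x\mapsto N_u^*\}\uplus\{\mathit{reflect}\,y\,f\mapsto N_b^*\}$ for $T=\mathtt{where}\{\mathtt{return}\,x=N_u;\ y\gg\!=f=N_b\}$, where $\mathit{reflect}$ is a fixed operation name. Then for all computations $M,N$ of the monadic reflection calculus, $M\to N$ implies $M^*\to^{+}N^*$.
   Context: Core syntax (shared). Values $V ::= x \mid () \mid (V_1,V_2) \mid \ell\,V \mid \{M\}$; computations $M,N ::= \mathtt{let}\,(x,y)=V\,\mathtt{in}\,M \mid \mathtt{case}\,V\,\mathtt{of}\,\{\ell_i x_i\mapsto M_i\}_i \mid V! \mid \mathtt{return}\,V \mid \mathtt{let}\,x\Leftarrow M\,\mathtt{in}\,N \mid \lambda x.M \mid M\,V \mid \langle M_1,M_2\rangle \mid \mathrm{prj}_i M$. Core $\beta$-rules: $\mathtt{let}\,(x,y)=(V_1,V_2)\,\mathtt{in}\,M \to_\beta M[V_1/x,V_2/y]$; $\mathtt{case}\,\ell_j V\,\mathtt{of}\,\{\dots\ell_j x_j\mapsto M_j\dots\}\to_\beta M_j[V/x_j]$; $\{M\}!\to_\beta M$; $\mathtt{let}\,x\Leftarrow\mathtt{return}\,V\,\mathtt{in}\,N\to_\beta N[V/x]$; $(\lambda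 x.M)V\to_\beta M[V/x]$; $\mathrm{prj}_i\langle M_1,M_2\rangle\to_\beta M_i$. Basic frames $B ::= \mathtt{let}\,x\Leftarrow[\,]\,\mathtt{in}\,N\mid[\,]\,V\mid\mathrm{prj}_i[\,]$; hoisting contexts $\mathcal{H}::=[\,]\mid\mathcal{H}[B]$. In each calculus $M\to N$ iff $M=K[M']$, $N=K[N']$ with $M'\to_\beta N'$ and $K$ an evaluation context of that calculus; $\to^+$ is the transitive closure. Monadic reflection calculus: monad terms $T=\mathtt{where}\{\mathtt{return}\,x=N_u;\ y\gg\!=f=N_b\}$; adds computations $\mathtt{reflect}\,N$ and $\mathtt{reify}_T\,M$; evaluation contexts $K::=[\,]\mid K[B]\mid K[\mathtt{reify}_T[\,]]$; extra rules $\mathtt{reify}_T(\mathtt{return}\,V)\to_\beta N_u[V/x]$ and $\mathtt{reify}_T\,\mathcal{H}[\mathtt{reflect}\,N]\to_\beta N_b[\{N\}/y,\{\lambda z.\mathtt{reify}_T\,\mathcal{H}[\mathtt{return}\,z]\}/f]$. Effect handler calculus: operation names $\mathit{op}$; adds computations $\mathit{op}\,V$ and $\mathtt{handle}\,M\,\mathtt{with}\,H$, where $H$ has a return clause $\mathtt{return}\,x\mapsto N_{\mathrm{ret}}$ and operation clauses $\mathit{op}\,p\,k\mapsto N_{\mathit{op}}$ for $\mathit{op}$ in a finite set $\mathrm{ops}(H)$; evaluation contexts $K::=[\,]\mid K[B]\mid K[\mathtt{handle}\,[\,]\,\mathtt{with}\,H]$; extra rules $\mathtt{handle}\,(\mathtt{return}\,V)\,\mathtt{with}\,H\to_\beta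 N_{\mathrm{ret}}[V/x]$ and $\mathtt{handle}\,\mathcal{H}[\mathit{op}\,V]\,\mathtt{with}\,H\to_\beta N_{\mathit{op}}[V/p,\{\lambda y.\mathtt{handle}\,\mathcal{H}[\mathtt{return}\,y]\,\mathtt{with}\,H\}/k]$ for $\mathit{op}\in\mathrm{ops}(H)$. -}

module Defs where

open import Data.Nat using (ℕ; zero; suc)
open import Data.Fin using (Fin; zero; suc)
open import Relation.Binary.PropositionalEquality using (_≡_)
open import Relation.Nullary using (¬_)

Label : Set
Label = ℕ

OpName : Set
OpName = ℕ

Ren : ℕ → ℕ → Set
Ren m n = Fin m → Fin n

ext : ∀ {m n} → Ren m n → Ren (suc m) (suc n)
ext ρ zero    = zero
ext ρ (suc i) = suc (ρ i)

module MR where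
  mutual
    data Val (n : ℕ) : Set where
      var   : Fin n → Val n
      unit  : Val n
      pair  : Val n → Val n → Val n
      inj   : Label → Val n → Val n
      thunk : Comp n → Val n

    data Comp (n : ℕ) : Set where
      letpair : Val n → Comp (suc (suc n)) → Comp n   -- let (x,y) = V in M ; x = var 0, y = var 1
      case    : Val n → Branches n → Comp n
      force   : Val n → Comp n
      return  : Val n → Comp n
      bind    : Comp n → Comp (suc n) → Comp n
      lam     : Comp (suc n) → Comp n
      app     : Comp n → Val n → Comp n
      tuple   : Comp n → Comp n → Comp n
      prj     : Fin 2 → Comp n → Comp n               -- prjᵢ M  (i = zero ~ 1, suc zero ~ 2)
      reflect : Comp n → Comp n
      reify   : Monad n → Comp n → Comp n

    data Branches (n : ℕ) : Set where
      []  : Branches n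
      br  : Label → Comp (suc n) → Branches n → Branches n

    -- T = where {return x = Nᵤ ; y >>= f = N_b} ; in N_b: y = var 0, f = var 1
    data Monad (n : ℕ) : Set where
      mon : Comp (suc n) → Comp (suc (suc n)) → Monad n

  mutual
    renV : ∀ {m n} → Ren m n → Val m → Val n
    renV ρ (var i)    = var (ρ i)
    renV ρ unit       = unit
    renV ρ (pair V W) = pair (renV ρ V) (renV ρ W)
    renV ρ (inj ℓ V)  = inj ℓ (renV ρ V)
    renV ρ (thunk M)  = thunk (renC ρ M)

    renC : ∀ {m n} → Ren m n → Comp m → Comp n
    renC ρ (letpair V M) = letpair (renV ρ V) (renC (ext (ext ρ)) M)
    renC ρ (case V bs)   = case (renV ρ V) (renBr ρ bs)
    renC ρ (force V)     = force (renV ρ V)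
    renC ρ (return V)    = return (renV ρ V)
    renC ρ (bind M N)    = bind (renC ρ M) (renC (ext ρ) N)
    renC ρ (lam M)       = lam (renC (ext ρ) M)
    renC ρ (app M V)     = app (renC ρ M) (renV ρ V)
    renC ρ (tuple M N)   = tuple (renC ρ M) (renC ρ N)
    renC ρ (prj i M)     = prj i (renC ρ M)
    renC ρ (reflect N)   = reflect (renC ρ N)
    renC ρ (reify T M)   = reify (renM ρ T) (renC ρ M)

    renBr : ∀ {m n} → Ren m n → Branches m → Branches n
    renBr ρ []          = []
    renBr ρ (br ℓ M bs) = br ℓ (renC (ext ρ) M) (renBr ρ bs)

    renM : ∀ {m n} → Ren m n → Monad m → Monad n
    renM ρ (mon Nu Nb) = mon (renC (ext ρ) Nu) (renC (ext (ext ρ)) Nb)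

  Sub : ℕ → ℕ → Set
  Sub m n = Fin m → Val n

  exts : ∀ {m n} → Sub m n → Sub (suc m) (suc n)
  exts σ zero    = var zero
  exts σ (suc i) = renV suc (σ i)

  mutual
    subV : ∀ {m n} → Sub m n → Val m → Val n
    subV σ (var i)    = σ i
    subV σ unit       = unit
    subV σ (pair V W) = pair (subV σ V) (subV σ W)
    subV σ (inj ℓ V)  = inj ℓ (subV σ V)
    subV σ (thunk M)  = thunk (subC σ M)

    subC : ∀ {m n} → Sub m n → Comp m → Comp n
    subC σ (letpair V M) = letpair (subV σ V) (subC (exts (exts σ)) M)
    subC σ (case V bs)   = case (subV σ V) (subBr σ bs)
    subC σ (force V)     = force (subV σ V)
    subC σ (return V)    = return (subV σ V)
    subC σ (bind M N)    = bind (subC σ M) (subC (exts σ) N)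
    subC σ (lam M)       = lam (subC (exts σ) M)
    subC σ (app M V)     = app (subC σ M) (subV σ V)
    subC σ (tuple M N)   = tuple (subC σ M) (subC σ N)
    subC σ (prj i M)     = prj i (subC σ M)
    subC σ (reflect N)   = reflect (subC σ N)
    subC σ (reify T M)   = reify (subM σ T) (subC σ M)

    subBr : ∀ {m n} → Sub m n → Branches m → Branches n
    subBr σ []          = []
    subBr σ (br ℓ M bs) = br ℓ (subC (exts σ) M) (subBr σ bs)

    subM : ∀ {m n} → Sub m n → Monad m → Monad n
    subM σ (mon Nu Nb) = mon (subC (exts σ) Nu) (subC (exts (exts σ)) Nb)

  sub1 : ∀ {n} → Val n → Sub (suc n) n
  sub1 V zero    = V
  sub1 V (suc i) = var i

  sub2 : ∀ {n} → Val n → Val n → Sub (suc (suc n)) n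
  sub2 V W zero          = V
  sub2 V W (suc zero)    = W
  sub2 V W (suc (suc i)) = var i

  select : ∀ {n} → Fin 2 → Comp n → Comp n → Comp n
  select zero    M N = M
  select (suc _) M N = N

  data BrLookup {n : ℕ} (ℓ : Label) : Branches n → Comp (suc n) → Set where
    here  : ∀ {M bs} → BrLookup ℓ (br ℓ M bs) M
    there : ∀ {ℓ′ M′ bs M} → ¬ (ℓ ≡ ℓ′) → BrLookup ℓ bs M → BrLookup ℓ (br ℓ′ M′ bs) M

  data Frame (n : ℕ) : Set where
    letF : Comp (suc n) → Frame n
    appF : Val n → Frame n
    prjF : Fin 2 → Frame n

  plugB : ∀ {n} → Frame n → Comp n → Comp n
  plugB (letF N) M = bind M N
  plugB (appF V) M = app M V
  plugB (prjF i) M = prj i M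

  renF : ∀ {m n} → Ren m n → Frame m → Frame n
  renF ρ (letF N) = letF (renC (ext ρ) N)
  renF ρ (appF V) = appF (renV ρ V)
  renF ρ (prjF i) = prjF i

  data HCtx (n : ℕ) : Set where
    hole : HCtx n
    _▷_  : HCtx n → Frame n → HCtx n

  plugH : ∀ {n} → HCtx n → Comp n → Comp n
  plugH hole    M = M
  plugH (H ▷ B) M = plugH H (plugB B M)

  renH : ∀ {m n} → Ren m n → HCtx m → HCtx n
  renH ρ hole    = hole
  renH ρ (H ▷ B) = renH ρ H ▷ renF ρ B

  data ECtx (n : ℕ) : Set where
    hole    : ECtx n
    _▷_     : ECtx n → Frame n → ECtx n
    _▷reify_ : ECtx n → Monad n → ECtx n

  plugE : ∀ {n} → ECtx n → Comp n → Comp n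
  plugE hole          M = M
  plugE (K ▷ B)       M = plugE K (plugB B M)
  plugE (K ▷reify T)  M = plugE K (reify T M)

  infix 4 _⟶β_ _⟶_

  data _⟶β_ {n : ℕ} : Comp n → Comp n → Set where
    β-letpair : ∀ {V W M} → letpair (pair V W) M ⟶β subC (sub2 V W) M
    β-case    : ∀ {ℓ V bs M} → BrLookup ℓ bs M → case (inj ℓ V) bs ⟶β subC (sub1 V) M
    β-force   : ∀ {M} → force (thunk M) ⟶β M
    β-bind    : ∀ {V N} → bind (return V) N ⟶β subC (sub1 V) N
    β-app     : ∀ {M V} → app (lam M) V ⟶β subC (sub1 V) M
    β-prj     : ∀ {i M N} → prj i (tuple M N) ⟶β select i M N
    β-reify-return  : ∀ {Nu Nb V} → reify (mon Nu Nb) (return V) ⟶β subC (sub1 V) Nu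
    β-reify-reflect : ∀ {Nu Nb N} (H : HCtx n) →
      reify (mon Nu Nb) (plugH H (reflect N)) ⟶β
      subC (sub2 (thunk N)
                 (thunk (lam (reify (renM suc (mon Nu Nb)) (plugH (renH suc H) (return (var zero)))))))
           Nb

  data _⟶_ {n : ℕ} : Comp n → Comp n → Set where
    step : ∀ {M N} (K : ECtx n) → M ⟶β N → plugE K M ⟶ plugE K N

module EH where
  mutual
    data Val (n : ℕ) : Set where
      var   : Fin n → Val n
      unit  : Val n
      pair  : Val n → Val n → Val n
      inj   : Label → Val n → Val n
      thunk : Comp n → Val n

    data Comp (n : ℕ) : Set where
      letpair : Val n → Comp (suc (suc n)) → Comp n
      case    : Val n → Branches n → Comp n
      force   : Val n → Comp n
      return  : Val n → Comp n
      bind    : Comp n → Comp (suc n) → Comp n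
      lam     : Comp (suc n) → Comp n
      app     : Comp n → Val n → Comp n
      tuple   : Comp n → Comp n → Comp n
      prj     : Fin 2 → Comp n → Comp n
      op      : OpName → Val n → Comp n
      handle  : Comp n → Handler n → Comp n

    data Branches (n : ℕ) : Set where
      []  : Branches n
      br  : Label → Comp (suc n) → Branches n → Branches n

    -- operation clauses  op p k ↦ N_op ; p = var 0, k = var 1
    data Clauses (n : ℕ) : Set where
      []  : Clauses n
      cl  : OpName → Comp (suc (suc n)) → Clauses n → Clauses n

    data Handler (n : ℕ) : Set where
      handler : Comp (suc n) → Clauses n → Handler n

  mutual
    renV : ∀ {m n} → Ren m n → Val m → Val n
    renV ρ (var i)    = var (ρ i)
    renV ρ unit       = unit
    renV ρ (pair V W) = pair (renV ρ V) (renV ρ W)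
    renV ρ (inj ℓ V)  = inj ℓ (renV ρ V)
    renV ρ (thunk M)  = thunk (renC ρ M)

    renC : ∀ {m n} → Ren m n → Comp m → Comp n
    renC ρ (letpair V M) = letpair (renV ρ V) (renC (ext (ext ρ)) M)
    renC ρ (case V bs)   = case (renV ρ V) (renBr ρ bs)
    renC ρ (force V)     = force (renV ρ V)
    renC ρ (return V)    = return (renV ρ V)
    renC ρ (bind M N)    = bind (renC ρ M) (renC (ext ρ) N)
    renC ρ (lam M)       = lam (renC (ext ρ) M)
    renC ρ (app M V)     = app (renC ρ M) (renV ρ V)
    renC ρ (tuple M N)   = tuple (renC ρ M) (renC ρ N)
    renC ρ (prj i M)     = prj i (renC ρ M)
    renC ρ (op o V)      = op o (renV ρ V)
    renC ρ (handle M H)  = handle (renC ρ M) (renHd ρ H)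

    renBr : ∀ {m n} → Ren m n → Branches m → Branches n
    renBr ρ []          = []
    renBr ρ (br ℓ M bs) = br ℓ (renC (ext ρ) M) (renBr ρ bs)

    renCl : ∀ {m n} → Ren m n → Clauses m → Clauses n
    renCl ρ []          = []
    renCl ρ (cl o N cs) = cl o (renC (ext (ext ρ)) N) (renCl ρ cs)

    renHd : ∀ {m n} → Ren m n → Handler m → Handler n
    renHd ρ (handler Nr cs) = handler (renC (ext ρ) Nr) (renCl ρ cs)

  Sub : ℕ → ℕ → Set
  Sub m n = Fin m → Val n

  exts : ∀ {m n} → Sub m n → Sub (suc m) (suc n)
  exts σ zero    = var zero
  exts σ (suc i) = renV suc (σ i)

  mutual
    subV : ∀ {m n} → Sub m n → Val m → Val n
    subV σ (var i)    = σ i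
    subV σ unit       = unit
    subV σ (pair V W) = pair (subV σ V) (subV σ W)
    subV σ (inj ℓ V)  = inj ℓ (subV σ V)
    subV σ (thunk M)  = thunk (subC σ M)

    subC : ∀ {m n} → Sub m n → Comp m → Comp n
    subC σ (letpair V M) = letpair (subV σ V) (subC (exts (exts σ)) M)
    subC σ (case V bs)   = case (subV σ V) (subBr σ bs)
    subC σ (force V)     = force (subV σ V)
    subC σ (return V)    = return (subV σ V)
    subC σ (bind M N)    = bind (subC σ M) (subC (exts σ) N)
    subC σ (lam M)       = lam (subC (exts σ) M)
    subC σ (app M V)     = app (subC σ M) (subV σ V)
    subC σ (tuple M N)   = tuple (subC σ M) (subC σ N)
    subC σ (prj i M)     = prj i (subC σ M)
    subC σ (op o V)      = op o (subV σ V)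
    subC σ (handle M H)  = handle (subC σ M) (subHd σ H)

    subBr : ∀ {m n} → Sub m n → Branches m → Branches n
    subBr σ []          = []
    subBr σ (br ℓ M bs) = br ℓ (subC (exts σ) M) (subBr σ bs)

    subCl : ∀ {m n} → Sub m n → Clauses m → Clauses n
    subCl σ []          = []
    subCl σ (cl o N cs) = cl o (subC (exts (exts σ)) N) (subCl σ cs)

    subHd : ∀ {m n} → Sub m n → Handler m → Handler n
    subHd σ (handler Nr cs) = handler (subC (exts σ) Nr) (subCl σ cs)

  sub1 : ∀ {n} → Val n → Sub (suc n) n
  sub1 V zero    = V
  sub1 V (suc i) = var i

  sub2 : ∀ {n} → Val n → Val n → Sub (suc (suc n)) n
  sub2 V W zero          = V
  sub2 V W (suc zero)    = W
  sub2 V W (suc (suc i)) = var i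

  select : ∀ {n} → Fin 2 → Comp n → Comp n → Comp n
  select zero    M N = M
  select (suc _) M N = N

  data BrLookup {n : ℕ} (ℓ : Label) : Branches n → Comp (suc n) → Set where
    here  : ∀ {M bs} → BrLookup ℓ (br ℓ M bs) M
    there : ∀ {ℓ′ M′ bs M} → ¬ (ℓ ≡ ℓ′) → BrLookup ℓ bs M → BrLookup ℓ (br ℓ′ M′ bs) M

  data ClLookup {n : ℕ} (o : OpName) : Clauses n → Comp (suc (suc n)) → Set where
    here  : ∀ {N cs} → ClLookup o (cl o N cs) N
    there : ∀ {o′ N′ cs N} → ¬ (o ≡ o′) → ClLookup o cs N → ClLookup o (cl o′ N′ cs) N

  data Frame (n : ℕ) : Set where
    letF : Comp (suc n) → Frame n
    appF : Val n → Frame n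
    prjF : Fin 2 → Frame n

  plugB : ∀ {n} → Frame n → Comp n → Comp n
  plugB (letF N) M = bind M N
  plugB (appF V) M = app M V
  plugB (prjF i) M = prj i M

  renF : ∀ {m n} → Ren m n → Frame m → Frame n
  renF ρ (letF N) = letF (renC (ext ρ) N)
  renF ρ (appF V) = appF (renV ρ V)
  renF ρ (prjF i) = prjF i

  data HCtx (n : ℕ) : Set where
    hole : HCtx n
    _▷_  : HCtx n → Frame n → HCtx n

  plugH : ∀ {n} → HCtx n → Comp n → Comp n
  plugH hole    M = M
  plugH (H ▷ B) M = plugH H (plugB B M)

  renH : ∀ {m n} → Ren m n → HCtx m → HCtx n
  renH ρ hole    = hole
  renH ρ (H ▷ B) = renH ρ H ▷ renF ρ B

  data ECtx (n : ℕ) : Set where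
    hole     : ECtx n
    _▷_      : ECtx n → Frame n → ECtx n
    _▷handle_ : ECtx n → Handler n → ECtx n

  plugE : ∀ {n} → ECtx n → Comp n → Comp n
  plugE hole           M = M
  plugE (K ▷ B)        M = plugE K (plugB B M)
  plugE (K ▷handle H)  M = plugE K (handle M H)

  infix 4 _⟶β_ _⟶_

  data _⟶β_ {n : ℕ} : Comp n → Comp n → Set where
    β-letpair : ∀ {V W M} → letpair (pair V W) M ⟶β subC (sub2 V W) M
    β-case    : ∀ {ℓ V bs M} → BrLookup ℓ bs M → case (inj ℓ V) bs ⟶β subC (sub1 V) M
    β-force   : ∀ {M} → force (thunk M) ⟶β M
    β-bind    : ∀ {V N} → bind (return V) N ⟶β subC (sub1 V) N
    β-app     : ∀ {M V} → app (lam M) V ⟶β subC (sub1 V) M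
    β-prj     : ∀ {i M N} → prj i (tuple M N) ⟶β select i M N
    β-handle-return : ∀ {Nr cs V} → handle (return V) (handler Nr cs) ⟶β subC (sub1 V) Nr
    β-handle-op     : ∀ {Nr cs o V N} (H : HCtx n) → ClLookup o cs N →
      handle (plugH H (op o V)) (handler Nr cs) ⟶β
      subC (sub2 V
                 (thunk (lam (handle (plugH (renH suc H) (return (var zero)))
                                     (renHd suc (handler Nr cs))))))
           N

  data _⟶_ {n : ℕ} : Comp n → Comp n → Set where
    step : ∀ {M N} (K : ECtx n) → M ⟶β N → plugE K M ⟶ plugE K N

module Translate (reflectOp : OpName) where
  mutual
    trV : ∀ {n} → MR.Val n → EH.Val n
    trV (MR.var i)    = EH.var i
    trV MR.unit       = EH.unit
    trV (MR.pair V W) = EH.pair (trV V) (trV W)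
    trV (MR.inj ℓ V)  = EH.inj ℓ (trV V)
    trV (MR.thunk M)  = EH.thunk (trC M)

    trC : ∀ {n} → MR.Comp n → EH.Comp n
    trC (MR.letpair V M) = EH.letpair (trV V) (trC M)
    trC (MR.case V bs)   = EH.case (trV V) (trBr bs)
    trC (MR.force V)     = EH.force (trV V)
    trC (MR.return V)    = EH.return (trV V)
    trC (MR.bind M N)    = EH.bind (trC M) (trC N)
    trC (MR.lam M)       = EH.lam (trC M)
    trC (MR.app M V)     = EH.app (trC M) (trV V)
    trC (MR.tuple M N)   = EH.tuple (trC M) (trC N)
    trC (MR.prj i M)     = EH.prj i (trC M)
    trC (MR.reflect N)   = EH.op reflectOp (EH.thunk (trC N))
    trC (MR.reify (MR.mon Nu Nb) M) =
      EH.handle (trC M) (EH.handler (trC Nu) (EH.cl reflectOp (trC Nb) EH.[]))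

    trBr : ∀ {n} → MR.Branches n → EH.Branches n
    trBr MR.[]          = EH.[]
    trBr (MR.br ℓ M bs) = EH.br ℓ (trC M) (trBr bs)

module Submission where

-- The translation is a compositional homomorphism, so it commutes with renaming,
-- substitution and plugging into contexts; a reify frame becomes a handle frame, so
-- evaluation contexts and hoisting contexts translate to contexts of the same kind.
-- Hence every β-rule of monadic reflection is mapped to exactly one β-rule of effect
-- handlers: reify-return to handle-return, and reify-reflect to handle-op with the
-- single reflect clause, whose captured resumption is precisely the translation of the
-- reified continuation λz. reify_T H[return z].

open import Defs
open import Data.Nat using (ℕ; suc)
open import Data.Fin using (zero; suc)
open import Relation.Binary.Construct.Closure.Transitive using (TransClosure; [_])
open import Relation.Binary.PropositionalEquality
  using (_≡_; refl; cong; cong₂; sym; trans; subst₂; module ≡-Reasoning)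

module Simulation (reflectOp : OpName) where
  open Translate reflectOp

  trMonad : ∀ {n} → MR.Monad n → EH.Handler n
  trMonad (MR.mon Nu Nb) = EH.handler (trC Nu) (EH.cl reflectOp (trC Nb) EH.[])

  trC-reify : ∀ {n} (T : MR.Monad n) (M : MR.Comp n) →
    trC (MR.reify T M) ≡ EH.handle (trC M) (trMonad T)
  trC-reify (MR.mon Nu Nb) M = refl

  mutual
    trV-renV : ∀ {m n} (ρ : Ren m n) (V : MR.Val m) → trV (MR.renV ρ V) ≡ EH.renV ρ (trV V)
    trV-renV ρ (MR.var i)    = refl
    trV-renV ρ MR.unit       = refl
    trV-renV ρ (MR.pair V W) = cong₂ EH.pair (trV-renV ρ V) (trV-renV ρ W)
    trV-renV ρ (MR.inj ℓ V)  = cong (EH.inj ℓ) (trV-renV ρ V)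
    trV-renV ρ (MR.thunk M)  = cong EH.thunk (trC-renC ρ M)

    trC-renC : ∀ {m n} (ρ : Ren m n) (M : MR.Comp m) → trC (MR.renC ρ M) ≡ EH.renC ρ (trC M)
    trC-renC ρ (MR.letpair V M) = cong₂ EH.letpair (trV-renV ρ V) (trC-renC (ext (ext ρ)) M)
    trC-renC ρ (MR.case V bs)   = cong₂ EH.case (trV-renV ρ V) (trBr-renBr ρ bs)
    trC-renC ρ (MR.force V)     = cong EH.force (trV-renV ρ V)
    trC-renC ρ (MR.return V)    = cong EH.return (trV-renV ρ V)
    trC-renC ρ (MR.bind M N)    = cong₂ EH.bind (trC-renC ρ M) (trC-renC (ext ρ) N)
    trC-renC ρ (MR.lam M)       = cong EH.lam (trC-renC (ext ρ) M)
    trC-renC ρ (MR.app M V)     = cong₂ EH.app (trC-renC ρ M) (trV-renV ρ V)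
    trC-renC ρ (MR.tuple M N)   = cong₂ EH.tuple (trC-renC ρ M) (trC-renC ρ N)
    trC-renC ρ (MR.prj i M)     = cong (EH.prj i) (trC-renC ρ M)
    trC-renC ρ (MR.reflect N)   = cong (λ N* → EH.op reflectOp (EH.thunk N*)) (trC-renC ρ N)
    trC-renC ρ (MR.reify (MR.mon Nu Nb) M) =
      cong₂ EH.handle (trC-renC ρ M) (trMonad-renM ρ (MR.mon Nu Nb))

    trBr-renBr : ∀ {m n} (ρ : Ren m n) (bs : MR.Branches m) →
      trBr (MR.renBr ρ bs) ≡ EH.renBr ρ (trBr bs)
    trBr-renBr ρ MR.[]          = refl
    trBr-renBr ρ (MR.br ℓ M bs) = cong₂ (EH.br ℓ) (trC-renC (ext ρ) M) (trBr-renBr ρ bs)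

    trMonad-renM : ∀ {m n} (ρ : Ren m n) (T : MR.Monad m) →
      trMonad (MR.renM ρ T) ≡ EH.renHd ρ (trMonad T)
    trMonad-renM ρ (MR.mon Nu Nb) =
      cong₂ (λ Nr Nop → EH.handler Nr (EH.cl reflectOp Nop EH.[]))
            (trC-renC (ext ρ) Nu) (trC-renC (ext (ext ρ)) Nb)

  Translates : ∀ {m n} → MR.Sub m n → EH.Sub m n → Set
  Translates σ τ = ∀ i → trV (σ i) ≡ τ i

  exts-translates : ∀ {m n} {σ : MR.Sub m n} {τ : EH.Sub m n} →
    Translates σ τ → Translates (MR.exts σ) (EH.exts τ)
  exts-translates σ≈τ zero = refl
  exts-translates {σ = σ} σ≈τ (suc i) = trans (trV-renV suc (σ i)) (cong (EH.renV suc) (σ≈τ i))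

  mutual
    trV-subV : ∀ {m n} {σ : MR.Sub m n} {τ : EH.Sub m n} → Translates σ τ →
      (V : MR.Val m) → trV (MR.subV σ V) ≡ EH.subV τ (trV V)
    trV-subV σ≈τ (MR.var i)    = σ≈τ i
    trV-subV σ≈τ MR.unit       = refl
    trV-subV σ≈τ (MR.pair V W) = cong₂ EH.pair (trV-subV σ≈τ V) (trV-subV σ≈τ W)
    trV-subV σ≈τ (MR.inj ℓ V)  = cong (EH.inj ℓ) (trV-subV σ≈τ V)
    trV-subV σ≈τ (MR.thunk M)  = cong EH.thunk (trC-subC σ≈τ M)

    trC-subC : ∀ {m n} {σ : MR.Sub m n} {τ : EH.Sub m n} → Translates σ τ →
      (M : MR.Comp m) → trC (MR.subC σ M) ≡ EH.subC τ (trC M)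
    trC-subC σ≈τ (MR.letpair V M) =
      cong₂ EH.letpair (trV-subV σ≈τ V) (trC-subC (exts-translates (exts-translates σ≈τ)) M)
    trC-subC σ≈τ (MR.case V bs)   = cong₂ EH.case (trV-subV σ≈τ V) (trBr-subBr σ≈τ bs)
    trC-subC σ≈τ (MR.force V)     = cong EH.force (trV-subV σ≈τ V)
    trC-subC σ≈τ (MR.return V)    = cong EH.return (trV-subV σ≈τ V)
    trC-subC σ≈τ (MR.bind M N)    = cong₂ EH.bind (trC-subC σ≈τ M) (trC-subC (exts-translates σ≈τ) N)
    trC-subC σ≈τ (MR.lam M)       = cong EH.lam (trC-subC (exts-translates σ≈τ) M)
    trC-subC σ≈τ (MR.app M V)     = cong₂ EH.app (trC-subC σ≈τ M) (trV-subV σ≈τ V)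
    trC-subC σ≈τ (MR.tuple M N)   = cong₂ EH.tuple (trC-subC σ≈τ M) (trC-subC σ≈τ N)
    trC-subC σ≈τ (MR.prj i M)     = cong (EH.prj i) (trC-subC σ≈τ M)
    trC-subC σ≈τ (MR.reflect N)   = cong (λ N* → EH.op reflectOp (EH.thunk N*)) (trC-subC σ≈τ N)
    trC-subC σ≈τ (MR.reify (MR.mon Nu Nb) M) =
      cong₂ EH.handle (trC-subC σ≈τ M) (trMonad-subM σ≈τ (MR.mon Nu Nb))

    trBr-subBr : ∀ {m n} {σ : MR.Sub m n} {τ : EH.Sub m n} → Translates σ τ →
      (bs : MR.Branches m) → trBr (MR.subBr σ bs) ≡ EH.subBr τ (trBr bs)
    trBr-subBr σ≈τ MR.[]          = refl
    trBr-subBr σ≈τ (MR.br ℓ M bs) =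
      cong₂ (EH.br ℓ) (trC-subC (exts-translates σ≈τ) M) (trBr-subBr σ≈τ bs)

    trMonad-subM : ∀ {m n} {σ : MR.Sub m n} {τ : EH.Sub m n} → Translates σ τ →
      (T : MR.Monad m) → trMonad (MR.subM σ T) ≡ EH.subHd τ (trMonad T)
    trMonad-subM σ≈τ (MR.mon Nu Nb) =
      cong₂ (λ Nr Nop → EH.handler Nr (EH.cl reflectOp Nop EH.[]))
            (trC-subC (exts-translates σ≈τ) Nu)
            (trC-subC (exts-translates (exts-translates σ≈τ)) Nb)

  sub1-translates : ∀ {n} (V : MR.Val n) → Translates (MR.sub1 V) (EH.sub1 (trV V))
  sub1-translates V zero    = refl
  sub1-translates V (suc i) = refl

  sub2-translates : ∀ {n} (V W : MR.Val n) →
    Translates (MR.sub2 V W) (EH.sub2 (trV V) (trV W))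
  sub2-translates V W zero          = refl
  sub2-translates V W (suc zero)    = refl
  sub2-translates V W (suc (suc i)) = refl

  trFrame : ∀ {n} → MR.Frame n → EH.Frame n
  trFrame (MR.letF N) = EH.letF (trC N)
  trFrame (MR.appF V) = EH.appF (trV V)
  trFrame (MR.prjF i) = EH.prjF i

  trC-plugB : ∀ {n} (B : MR.Frame n) (M : MR.Comp n) →
    trC (MR.plugB B M) ≡ EH.plugB (trFrame B) (trC M)
  trC-plugB (MR.letF N) M = refl
  trC-plugB (MR.appF V) M = refl
  trC-plugB (MR.prjF i) M = refl

  trFrame-renF : ∀ {m n} (ρ : Ren m n) (B : MR.Frame m) →
    trFrame (MR.renF ρ B) ≡ EH.renF ρ (trFrame B)
  trFrame-renF ρ (MR.letF N) = cong EH.letF (trC-renC (ext ρ) N)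
  trFrame-renF ρ (MR.appF V) = cong EH.appF (trV-renV ρ V)
  trFrame-renF ρ (MR.prjF i) = refl

  trHCtx : ∀ {n} → MR.HCtx n → EH.HCtx n
  trHCtx MR.hole      = EH.hole
  trHCtx (H MR.▷ B) = trHCtx H EH.▷ trFrame B

  trC-plugH : ∀ {n} (H : MR.HCtx n) (M : MR.Comp n) →
    trC (MR.plugH H M) ≡ EH.plugH (trHCtx H) (trC M)
  trC-plugH MR.hole     M = refl
  trC-plugH (H MR.▷ B) M =
    trans (trC-plugH H (MR.plugB B M)) (cong (EH.plugH (trHCtx H)) (trC-plugB B M))

  trHCtx-renH : ∀ {m n} (ρ : Ren m n) (H : MR.HCtx m) →
    trHCtx (MR.renH ρ H) ≡ EH.renH ρ (trHCtx H)
  trHCtx-renH ρ MR.hole     = refl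
  trHCtx-renH ρ (H MR.▷ B) = cong₂ EH._▷_ (trHCtx-renH ρ H) (trFrame-renF ρ B)

  trECtx : ∀ {n} → MR.ECtx n → EH.ECtx n
  trECtx MR.hole           = EH.hole
  trECtx (K MR.▷ B)       = trECtx K EH.▷ trFrame B
  trECtx (K MR.▷reify T) = trECtx K EH.▷handle trMonad T

  trC-plugE : ∀ {n} (K : MR.ECtx n) (M : MR.Comp n) →
    trC (MR.plugE K M) ≡ EH.plugE (trECtx K) (trC M)
  trC-plugE MR.hole           M = refl
  trC-plugE (K MR.▷ B)       M =
    trans (trC-plugE K (MR.plugB B M)) (cong (EH.plugE (trECtx K)) (trC-plugB B M))
  trC-plugE (K MR.▷reify T) M =
    trans (trC-plugE K (MR.reify T M)) (cong (EH.plugE (trECtx K)) (trC-reify T M))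

  trBrLookup : ∀ {n ℓ} {bs : MR.Branches n} {M : MR.Comp (suc n)} →
    MR.BrLookup ℓ bs M → EH.BrLookup ℓ (trBr bs) (trC M)
  trBrLookup MR.here          = EH.here
  trBrLookup (MR.there ℓ≢ lk) = EH.there ℓ≢ (trBrLookup lk)

  ⟶β-≡ : ∀ {n} {M N N′ : EH.Comp n} → M EH.⟶β N → N′ ≡ N → M EH.⟶β N′
  ⟶β-≡ M⟶N refl = M⟶N

  trC-reifiedContinuation : ∀ {n} (T : MR.Monad n) (H : MR.HCtx n) →
    trC (MR.reify (MR.renM suc T) (MR.plugH (MR.renH suc H) (MR.return (MR.var zero))))
      ≡ EH.handle (EH.plugH (EH.renH suc (trHCtx H)) (EH.return (EH.var zero)))
                  (EH.renHd suc (trMonad T))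
  trC-reifiedContinuation T H = begin
    trC (MR.reify (MR.renM suc T) (MR.plugH (MR.renH suc H) z))
      ≡⟨ trC-reify (MR.renM suc T) _ ⟩
    EH.handle (trC (MR.plugH (MR.renH suc H) z)) (trMonad (MR.renM suc T))
      ≡⟨ cong₂ EH.handle (trC-plugH (MR.renH suc H) z) (trMonad-renM suc T) ⟩
    EH.handle (EH.plugH (trHCtx (MR.renH suc H)) (trC z)) (EH.renHd suc (trMonad T))
      ≡⟨ cong (λ H* → EH.handle (EH.plugH H* (trC z)) _) (trHCtx-renH suc H) ⟩
    EH.handle (EH.plugH (EH.renH suc (trHCtx H)) (trC z)) (EH.renHd suc (trMonad T))
      ∎
    where
      open ≡-Reasoning
      z = MR.return (MR.var zero)

  trC-⟶β : ∀ {n} {M N : MR.Comp n} → M MR.⟶β N → trC M EH.⟶β trC N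
  trC-⟶β (MR.β-letpair {V} {W} {M}) = ⟶β-≡ EH.β-letpair (trC-subC (sub2-translates V W) M)
  trC-⟶β (MR.β-case {V = V} {M = M} lk) =
    ⟶β-≡ (EH.β-case (trBrLookup lk)) (trC-subC (sub1-translates V) M)
  trC-⟶β MR.β-force                 = EH.β-force
  trC-⟶β (MR.β-bind {V} {N})        = ⟶β-≡ EH.β-bind (trC-subC (sub1-translates V) N)
  trC-⟶β (MR.β-app {M} {V})         = ⟶β-≡ EH.β-app (trC-subC (sub1-translates V) M)
  trC-⟶β (MR.β-prj {zero})          = EH.β-prj
  trC-⟶β (MR.β-prj {suc zero})      = EH.β-prj
  trC-⟶β (MR.β-reify-return {Nu} {Nb} {V}) =
    ⟶β-≡ EH.β-handle-return (trC-subC (sub1-translates V) Nu)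
  trC-⟶β (MR.β-reify-reflect {Nu} {Nb} {N} H) =
    subst₂ EH._⟶β_ redex contractum (EH.β-handle-op (trHCtx H) EH.here)
    where
      T = MR.mon Nu Nb
      redex : EH.handle (EH.plugH (trHCtx H) (trC (MR.reflect N))) (trMonad T)
            ≡ trC (MR.reify T (MR.plugH H (MR.reflect N)))
      redex = cong (λ M* → EH.handle M* (trMonad T)) (sym (trC-plugH H (MR.reflect N)))
      contractum = sym (trans
        (trC-subC (sub2-translates (MR.thunk N) _) Nb)
        (cong (λ k → EH.subC (EH.sub2 (EH.thunk (trC N)) (EH.thunk (EH.lam k))) (trC Nb))
              (trC-reifiedContinuation T H)))

  trC-⟶ : ∀ {n} {M N : MR.Comp n} → M MR.⟶ N → trC M EH.⟶ trC N
  trC-⟶ (MR.step {M} {N} K M⟶N) =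
    subst₂ EH._⟶_ (sym (trC-plugE K M)) (sym (trC-plugE K N))
      (EH.step (trECtx K) (trC-⟶β M⟶N))

theorem6p8 : (reflectOp : OpName) {n : ℕ} {M N : MR.Comp n} →
    M MR.⟶ N →
    TransClosure EH._⟶_ (Translate.trC reflectOp M) (Translate.trC reflectOp N)
theorem6p8 reflectOp M⟶N = [ trC-⟶ M⟶N ]
  where open Simulation reflectOp
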